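{- Let $t\ge2$, $n\ge1$, and let $\lambda$ be a $t$-core with $\ell(\lambda)\le tn$. Then the rank of $\lambda$ equals $\sum_{i=0}^{t-1}\big(n_i(\lambda,tn)-n\big)_+$, where $z_+=\max(z,0)$.
   Context: The rank of a partition is the largest $k$ with $\lambda_k\ge k$ (0 for the empty partition). For $\ell(\lambda)\le m$, $\beta(\lambda,m)=(\lambda_j+m-j)_{j=1}^m$ and $n_i(\lambda,m)$ is the number of its entries congruent to $i$ mod $t$. A $t$-core is a partition with no cell of hook length divisible by $t$. -}

module Defs where

open import Data.Nat using (ℕ; zero; suc; _+_; _*_; _∸_; _≤_; _≥_; _<_; _⊔_; _≤?_; _≟_; _%_; NonZero)
open import Data.Nat.Divisibility using (_∣_)
open import Data.List using (List; []; _∷_; length; map; upTo; filter)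
open import Data.List.Relation.Unary.All using (All)
open import Data.List.Relation.Unary.Linked using (Linked)
open import Relation.Nullary using (¬_)
open import Relation.Binary.PropositionalEquality using (_≡_)

IsPartition : List ℕ → Set
IsPartition lam = All (λ x → 1 ≤ x) lam × Linked _≥_ lam
  where open import Data.Product using (_×_)

-- λ_j, 1-indexed, with λ_j = 0 for j > ℓ(λ) (and for j = 0, never used).
part : List ℕ → ℕ → ℕ
part []       _             = 0
part (x ∷ xs) zero          = 0
part (x ∷ xs) (suc zero)    = x
part (x ∷ xs) (suc (suc j)) = part xs (suc j)

-- Rank: the largest k with λ_k ≥ k (0 if none).  rankFrom k xs scans positions k, k+1, …
rankFrom : ℕ → List ℕ → ℕ
rankFrom k []       = 0
rankFrom k (x ∷ xs) with k ≤? x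
... | Relation.Nullary.yes _ = k ⊔ rankFrom (suc k) xs
... | Relation.Nullary.no  _ = rankFrom (suc k) xs

rank : List ℕ → ℕ
rank lam = rankFrom 1 lam

conj : List ℕ → ℕ → ℕ
conj lam j = length (filter (λ x → j ≤? x) lam)

hook : List ℕ → ℕ → ℕ → ℕ
hook lam i j = (part lam i ∸ j) + (conj lam j ∸ i) + 1

IsCore : ℕ → List ℕ → Set
IsCore t lam = ∀ i j → 1 ≤ i → i ≤ length lam → 1 ≤ j → j ≤ part lam i →
               ¬ (t ∣ hook lam i j)

beta : List ℕ → ℕ → List ℕ
beta lam m = map (λ j → part lam (suc j) + (m ∸ suc j)) (upTo m)

nres : (t : ℕ) .{{_ : NonZero t}} → ℕ → List ℕ → ℕ → ℕ
nres t i lam m = length (filter (λ b → b % t ≟ i) (beta lam m))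

module Submission where

-- With M = t n, the β-numbers β j = λ_{j+1} + M − (j + 1), j < M, are strictly decreasing, and
-- λ_{j+1} ≥ j + 1 iff β j ≥ M, so the rank of λ is the number of β-numbers ≥ M.  A number y < β p
-- that is not a β-number yields a cell in row p + 1 of hook length β p − y; hence for a t-core the
-- β-numbers are closed under subtracting t.  The β-numbers congruent to i mod t are therefore
-- i, i + t, …, i + (n_i − 1) t, and exactly n_i ∸ n of them are ≥ t n.  Summing over i gives the rank.

open import Defs
open import Data.Nat
  using (ℕ; zero; suc; _+_; _*_; _∸_; _≤_; _<_; _≥_; _⊔_; _≤?_; _<?_; _≟_; _%_; _/_;
         NonZero; >-nonZero⁻¹; z≤n; s≤s; z<s; s<s; s≤s⁻¹; s<s⁻¹)
open import Data.Nat.Properties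
open import Data.Nat.DivMod using (m≡m%n+[m/n]*n; [m+kn]%n≡m%n; m<n⇒m%n≡m; m%n<n)
open import Data.Nat.Divisibility using (_∣_; ∣-refl)
open import Data.Nat.ListAction using (sum)
open import Data.Nat.Tactic.RingSolver using (solve-∀)
open import Data.List using (List; []; _∷_; length; map; upTo; applyUpTo; filter)
open import Data.List.Properties using (map-upTo; filter-accept; filter-reject)
open import Data.List.Relation.Unary.Linked using (Linked; _∷_; tail)
open import Data.Product using (_×_; _,_; ∃-syntax)
open import Data.Sum using (inj₁; inj₂)
open import Data.Empty using (⊥-elim)
open import Function using (_∘_; _⇔_; mk⇔; Equivalence)
open import Function.Construct.Symmetry using (⇔-sym)
open import Relation.Nullary using (¬_; Dec; yes; no; contradiction)
open import Relation.Unary using (Decidable)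
open import Relation.Binary.PropositionalEquality
open import Relation.Binary.Definitions using (tri<; tri≈; tri>)
open import Algebra.Properties.CommutativeSemigroup +-commutativeSemigroup using (interchange; xy∙z≈xz∙y)

𝟙 : {P : Set} → Dec P → ℕ
𝟙 (yes _) = 1
𝟙 (no _)  = 0

𝟙-yes : {P : Set} → P → (d : Dec P) → 𝟙 d ≡ 1
𝟙-yes p (yes _) = refl
𝟙-yes p (no ¬p) = contradiction p ¬p

𝟙-no : {P : Set} → ¬ P → (d : Dec P) → 𝟙 d ≡ 0
𝟙-no ¬p (yes p) = contradiction p ¬p
𝟙-no ¬p (no _)  = refl

𝟙-cong : {P Q : Set} → P ⇔ Q → (d : Dec P) (e : Dec Q) → 𝟙 d ≡ 𝟙 e
𝟙-cong P⇔Q (yes p) e = sym (𝟙-yes (Equivalence.to P⇔Q p) e)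
𝟙-cong P⇔Q (no ¬p) e = sym (𝟙-no (¬p ∘ Equivalence.from P⇔Q) e)

𝟙-*-pos : {P Q : Set} (d : Dec P) (e : Dec Q) → 0 < 𝟙 d * 𝟙 e → P × Q
𝟙-*-pos (yes p) (yes q) _ = p , q

∑ : ℕ → (ℕ → ℕ) → ℕ
∑ M q = sum (applyUpTo q M)

∑-cong : ∀ M {q r : ℕ → ℕ} → (∀ j → j < M → q j ≡ r j) → ∑ M q ≡ ∑ M r
∑-cong zero    eq = refl
∑-cong (suc M) eq = cong₂ _+_ (eq 0 z<s) (∑-cong M (λ j j<M → eq (suc j) (s<s j<M)))

∑-zero : ∀ M {q : ℕ → ℕ} → (∀ j → j < M → q j ≡ 0) → ∑ M q ≡ 0
∑-zero zero    _  = refl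
∑-zero (suc M) eq = cong₂ _+_ (eq 0 z<s) (∑-zero M (λ j j<M → eq (suc j) (s<s j<M)))

∑-distrib-+ : ∀ M (q r : ℕ → ℕ) → ∑ M (λ j → q j + r j) ≡ ∑ M q + ∑ M r
∑-distrib-+ zero    q r = refl
∑-distrib-+ (suc M) q r =
  trans (cong (q 0 + r 0 +_) (∑-distrib-+ M (q ∘ suc) (r ∘ suc))) (interchange (q 0) (r 0) _ _)

∑-distribʳ-* : ∀ M (q : ℕ → ℕ) c → ∑ M (λ j → q j * c) ≡ ∑ M q * c
∑-distribʳ-* zero    q c = refl
∑-distribʳ-* (suc M) q c =
  trans (cong (q 0 * c +_) (∑-distribʳ-* M (q ∘ suc) c)) (sym (*-distribʳ-+ c (q 0) _))

∑-comm : ∀ M T (a : ℕ → ℕ → ℕ) → ∑ M (λ j → ∑ T (a j)) ≡ ∑ T (λ i → ∑ M (λ j → a j i))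
∑-comm zero    T a = sym (∑-zero T (λ _ _ → refl))
∑-comm (suc M) T a = trans (cong (∑ T (a 0) +_) (∑-comm M T (a ∘ suc)))
                           (sym (∑-distrib-+ T (a 0) (λ i → ∑ M (λ j → a (suc j) i))))

≤-∑ : ∀ M (q : ℕ → ℕ) {j} → j < M → q j ≤ ∑ M q
≤-∑ (suc M) q {zero}  _         = m≤m+n (q 0) _
≤-∑ (suc M) q {suc j} (s<s j<M) = ≤-trans (≤-∑ M (q ∘ suc) j<M) (m≤n+m _ (q 0))

∑-pos : ∀ M (q : ℕ → ℕ) → 0 < ∑ M q → ∃[ j ] j < M × 0 < q j
∑-pos (suc M) q pos with q 0 in eq
... | suc _ = 0 , z<s , subst (0 <_) (sym eq) z<s
... | zero with ∑-pos M (q ∘ suc) pos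
...   | j , j<M , qj>0 = suc j , s<s j<M , qj>0

length-filter-applyUpTo : ∀ {P : ℕ → Set} (P? : Decidable P) (h : ℕ → ℕ) M →
  length (filter P? (applyUpTo h M)) ≡ ∑ M (λ j → 𝟙 (P? (h j)))
length-filter-applyUpTo P? h zero = refl
length-filter-applyUpTo P? h (suc M) with P? (h 0)
... | yes _ = cong suc (length-filter-applyUpTo P? (h ∘ suc) M)
... | no  _ = length-filter-applyUpTo P? (h ∘ suc) M

∑-𝟙-initial : ∀ {P : ℕ → Set} (P? : Decidable P) M K → K ≤ M →
  (∀ j → j < M → P j ⇔ j < K) → ∑ M (𝟙 ∘ P?) ≡ K
∑-𝟙-initial P? zero    zero    _         _    = refl
∑-𝟙-initial P? (suc M) zero    _         P⇔< =
  ∑-zero (suc M) (λ j j<M → 𝟙-no (n≮0 ∘ Equivalence.to (P⇔< j j<M)) (P? j))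
∑-𝟙-initial P? (suc M) (suc K) (s≤s K≤M) P⇔< =
  cong₂ _+_ (𝟙-yes (Equivalence.from (P⇔< 0 z<s) z<s) (P? 0))
            (∑-𝟙-initial (P? ∘ suc) M K K≤M (λ j j<M → mk⇔ (s<s⁻¹ ∘ Equivalence.to (P⇔< (suc j) (s<s j<M)))
                                                        (Equivalence.from (P⇔< (suc j) (s<s j<M)) ∘ s<s)))

∑-𝟙-≟ : ∀ T v → v < T → ∑ T (λ i → 𝟙 (v ≟ i)) ≡ 1
∑-𝟙-≟ (suc T) zero    _ = cong₂ _+_ (𝟙-yes refl (0 ≟ 0)) (∑-zero T (λ i _ → 𝟙-no (λ ()) (0 ≟ suc i)))
∑-𝟙-≟ (suc T) (suc v) (s<s v<T) = cong₂ _+_ (𝟙-no (λ ()) (suc v ≟ 0))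
  (trans (∑-cong T (λ i _ → 𝟙-cong (mk⇔ suc-injective (cong suc)) (suc v ≟ suc i) (v ≟ i))) (∑-𝟙-≟ T v v<T))

∑-𝟙-≟-≤1 : ∀ M (f : ℕ → ℕ) v → (∀ {i j} → i < M → j < M → f i ≡ f j → i ≡ j) →
  ∑ M (λ j → 𝟙 (f j ≟ v)) ≤ 1
∑-𝟙-≟-≤1 zero    f v inj = z≤n
∑-𝟙-≟-≤1 (suc M) f v inj with f 0 ≟ v
... | yes f0≡v = ≤-reflexive (cong suc (∑-zero M (λ j j<M → 𝟙-no (later≢v j<M) _)))
  where
  later≢v : ∀ {j} → j < M → f (suc j) ≢ v
  later≢v j<M fj≡v = 0≢1+n (inj z<s (s<s j<M) (trans f0≡v (sym fj≡v)))
... | no  _    = ∑-𝟙-≟-≤1 M (f ∘ suc) v (λ i<M j<M eq → suc-injective (inj (s<s i<M) (s<s j<M) eq))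

initial-segment : ∀ {P : ℕ → Set} (P? : Decidable P) M →
  (∀ {i j} → i ≤ j → j < M → P j → P i) → ∃[ K ] K ≤ M × (∀ j → j < M → P j ⇔ j < K)
initial-segment P? zero    _    = 0 , z≤n , λ _ ()
initial-segment {P} P? (suc M) down with P? M
... | yes PM = suc M , ≤-refl , λ j j<1+M → mk⇔ (λ _ → j<1+M) (λ _ → down (s≤s⁻¹ j<1+M) (n<1+n M) PM)
... | no ¬PM with initial-segment P? M (λ i≤j j<M → down i≤j (m<n⇒m<1+n j<M))
...   | K , K≤M , P⇔<K = K , m≤n⇒m≤1+n K≤M , P⇔<K′
  where
  P⇔<K′ : ∀ j → j < suc M → P j ⇔ j < K
  P⇔<K′ j j<1+M with m<1+n⇒m<n∨m≡n j<1+M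
  ... | inj₁ j<M  = P⇔<K j j<M
  ... | inj₂ refl = mk⇔ (λ PM → contradiction PM ¬PM) (λ M<K → contradiction K≤M (<⇒≱ M<K))

unit-decrements⇒≡∸ : (g r : ℕ → ℕ) → (∀ k → g k ≡ g (suc k) + r k) → (∀ k → r k ≤ 1) →
  (∀ k → 0 < g k → 1 ≤ r k) → ∀ k → g k ≡ g 0 ∸ k
unit-decrements⇒≡∸ g r split r≤1 r≥1 zero    = refl
unit-decrements⇒≡∸ g r split r≤1 r≥1 (suc k) = begin
  g (suc k)     ≡⟨ decrement k ⟩
  g k ∸ 1       ≡⟨ cong (_∸ 1) (unit-decrements⇒≡∸ g r split r≤1 r≥1 k) ⟩
  g 0 ∸ k ∸ 1   ≡⟨ ∸-+-assoc (g 0) k 1 ⟩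
  g 0 ∸ (k + 1) ≡⟨ cong (g 0 ∸_) (+-comm k 1) ⟩
  g 0 ∸ suc k   ∎
  where
  open ≡-Reasoning
  decrement : ∀ k → g (suc k) ≡ g k ∸ 1
  decrement k with g k in eq
  ... | zero  = m+n≡0⇒m≡0 (g (suc k)) (trans (sym (split k)) eq)
  ... | suc m = begin
    g (suc k)           ≡⟨ m+n∸n≡m (g (suc k)) 1 ⟨
    g (suc k) + 1 ∸ 1   ≡⟨ cong (λ x → g (suc k) + x ∸ 1) r≡1 ⟨
    g (suc k) + r k ∸ 1 ≡⟨ cong (_∸ 1) (trans (sym (split k)) eq) ⟩
    suc m ∸ 1           ∎
    where
    r≡1 : r k ≡ 1
    r≡1 = ≤-antisym (r≤1 k) (r≥1 k (subst (0 <_) (sym eq) z<s))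

t*k≤i+t*q⇔k≤q : ∀ t i k q → i < t → t * k ≤ i + t * q ⇔ k ≤ q
t*k≤i+t*q⇔k≤q t i k q i<t = mk⇔ (λ tk≤ → ≮⇒≥ (λ q<k → <⇒≱ (below q<k) tk≤))
                                 (λ k≤q → ≤-trans (*-monoʳ-≤ t k≤q) (m≤n+m (t * q) i))
  where
  open ≤-Reasoning
  below : q < k → i + t * q < t * k
  below q<k = begin-strict
    i + t * q <⟨ +-monoˡ-< (t * q) i<t ⟩
    t + t * q ≡⟨ *-suc t q ⟨
    t * suc q ≤⟨ *-monoʳ-≤ t q<k ⟩
    t * k     ∎

𝟙-≤-split : ∀ k q → 𝟙 (k ≤? q) ≡ 𝟙 (suc k ≤? q) + 𝟙 (q ≟ k)
𝟙-≤-split k q with k ≤? q | suc k ≤? q | q ≟ k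
... | yes _   | yes _   | no _    = refl
... | yes _   | no _    | yes _   = refl
... | no _    | no _    | no _    = refl
... | yes _   | yes k<q | yes refl = contradiction k<q (n≮n k)
... | yes k≤q | no k≮q  | no q≢k  = contradiction (≤∧≢⇒< k≤q (q≢k ∘ sym)) k≮q
... | no k≰q  | yes k<q | _       = contradiction (<⇒≤ k<q) k≰q
... | no k≰q  | no _    | yes refl = contradiction ≤-refl k≰q

module _ (t : ℕ) .{{_ : NonZero t}} where

  [i+t*k]%t≡i : ∀ i k → i < t → (i + t * k) % t ≡ i
  [i+t*k]%t≡i i k i<t = begin
    (i + t * k) % t ≡⟨ cong (λ m → (i + m) % t) (*-comm t k) ⟩
    (i + k * t) % t ≡⟨ [m+kn]%n≡m%n i k t ⟩
    i % t           ≡⟨ m<n⇒m%n≡m i<t ⟩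
    i               ∎
    where open ≡-Reasoning

  x%t≡i⇒x≡i+t*[x/t] : ∀ x i → x % t ≡ i → x ≡ i + t * (x / t)
  x%t≡i⇒x≡i+t*[x/t] x i x%t≡i = trans (m≡m%n+[m/n]*n x t) (cong₂ _+_ x%t≡i (*-comm (x / t) t))

  x%t≡i∧t*k≤x⇒x≡i+t*k+t*d : ∀ x i k → i < t → x % t ≡ i → t * k ≤ x → ∃[ d ] x ≡ i + t * k + t * d
  x%t≡i∧t*k≤x⇒x≡i+t*k+t*d x i k i<t x%t≡i tk≤x = x / t ∸ k , (begin
    x                             ≡⟨ x%t≡i⇒x≡i+t*[x/t] x i x%t≡i ⟩
    i + t * (x / t)               ≡⟨ cong (λ m → i + t * m) (m+[n∸m]≡n k≤x/t) ⟨
    i + t * (k + (x / t ∸ k))     ≡⟨ cong (i +_) (*-distribˡ-+ t k _) ⟩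
    i + (t * k + t * (x / t ∸ k)) ≡⟨ +-assoc i (t * k) _ ⟨
    i + t * k + t * (x / t ∸ k)   ∎)
    where
    open ≡-Reasoning
    k≤x/t : k ≤ x / t
    k≤x/t = Equivalence.to (t*k≤i+t*q⇔k≤q t i k (x / t) i<t) (subst (t * k ≤_) (x%t≡i⇒x≡i+t*[x/t] x i x%t≡i) tk≤x)

  residue-threshold-split : ∀ i k x → i < t →
    𝟙 (x % t ≟ i) * 𝟙 (t * k ≤? x) ≡ 𝟙 (x % t ≟ i) * 𝟙 (t * suc k ≤? x) + 𝟙 (x ≟ i + t * k)
  residue-threshold-split i k x i<t with x % t ≟ i
  ... | no x%t≢i = sym (𝟙-no (λ x≡ → x%t≢i (trans (cong (_% t) x≡) ([i+t*k]%t≡i i k i<t))) _)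
  ... | yes x%t≡i = begin
    1 * 𝟙 (t * k ≤? x)                              ≡⟨ *-identityˡ _ ⟩
    𝟙 (t * k ≤? x)                                  ≡⟨ 𝟙-cong (t*k≤x⇔k≤q k) (t * k ≤? x) (k ≤? q) ⟩
    𝟙 (k ≤? q)                                      ≡⟨ 𝟙-≤-split k q ⟩
    𝟙 (suc k ≤? q) + 𝟙 (q ≟ k)
      ≡⟨ cong₂ _+_ (𝟙-cong (⇔-sym (t*k≤x⇔k≤q (suc k))) (suc k ≤? q) (t * suc k ≤? x))
                   (𝟙-cong (mk⇔ same-quotient⇒ ⇒same-quotient) (q ≟ k) (x ≟ i + t * k)) ⟩
    𝟙 (t * suc k ≤? x) + 𝟙 (x ≟ i + t * k)          ≡⟨ cong (_+ 𝟙 (x ≟ i + t * k)) (*-identityˡ _) ⟨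
    1 * 𝟙 (t * suc k ≤? x) + 𝟙 (x ≟ i + t * k)      ∎
    where
    open ≡-Reasoning
    q = x / t
    x≡ : x ≡ i + t * q
    x≡ = x%t≡i⇒x≡i+t*[x/t] x i x%t≡i
    t*k≤x⇔k≤q : ∀ k → t * k ≤ x ⇔ k ≤ q
    t*k≤x⇔k≤q k = subst (λ y → t * k ≤ y ⇔ k ≤ q) (sym x≡) (t*k≤i+t*q⇔k≤q t i k q i<t)
    same-quotient⇒ : q ≡ k → x ≡ i + t * k
    same-quotient⇒ refl = x≡
    ⇒same-quotient : x ≡ i + t * k → q ≡ k
    ⇒same-quotient x≡′ = *-cancelˡ-≡ q k t (+-cancelˡ-≡ i _ _ (trans (sym x≡) x≡′))

head-≥-part : ∀ {x xs} → Linked _≥_ (x ∷ xs) → part xs 1 ≤ x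
head-≥-part {xs = []}    _         = z≤n
head-≥-part {xs = _ ∷ _} (y≤x ∷ _) = y≤x

part-antitone : ∀ {lam} → Linked _≥_ lam → ∀ {i j} → i ≤ j → part lam (suc j) ≤ part lam (suc i)
part-antitone {[]}     _ _                         = z≤n
part-antitone {x ∷ xs} _ {zero}  {zero}  _         = ≤-refl
part-antitone {x ∷ xs} l {zero}  {suc j} _         = ≤-trans (part-antitone (tail l) z≤n) (head-≥-part l)
part-antitone {x ∷ xs} l {suc i} {suc j} (s≤s i≤j) = part-antitone (tail l) i≤j

part-beyond-length : ∀ lam {j} → length lam ≤ j → part lam (suc j) ≡ 0
part-beyond-length []                 _         = refl
part-beyond-length (x ∷ xs) {suc j} (s≤s len≤j) = part-beyond-length xs len≤j

part-pos⇒≤length : ∀ lam {j} → 0 < part lam (suc j) → suc j ≤ length lam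
part-pos⇒≤length (x ∷ xs) {zero}  _   = s≤s z≤n
part-pos⇒≤length (x ∷ xs) {suc j} pos = s≤s (part-pos⇒≤length xs pos)

conj-≡ : ∀ {lam} → Linked _≥_ lam → ∀ c K → (∀ j → j < K → c ≤ part lam (suc j)) →
  part lam (suc K) < c → conj lam c ≡ K
conj-≡ {[]}     _ c zero    _     _     = refl
conj-≡ {[]}     _ c (suc K) above below = contradiction (above 0 z<s) (<⇒≱ below)
conj-≡ {x ∷ xs} l c zero    _     x<c   =
  trans (cong length (filter-reject (c ≤?_) (<⇒≱ x<c)))
        (conj-≡ (tail l) c 0 (λ _ ()) (≤-<-trans (head-≥-part l) x<c))
conj-≡ {x ∷ xs} l c (suc K) above below =
  trans (cong length (filter-accept (c ≤?_) (above 0 z<s)))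
        (cong suc (conj-≡ (tail l) c K (λ j j<K → above (suc j) (s<s j<K)) below))

rankFrom-≡0 : ∀ {xs} → Linked _≥_ xs → ∀ k → part xs 1 < k → rankFrom k xs ≡ 0
rankFrom-≡0 {[]}     _ k _   = refl
rankFrom-≡0 {x ∷ xs} l k x<k with k ≤? x
... | yes k≤x = contradiction k≤x (<⇒≱ x<k)
... | no  _   = rankFrom-≡0 (tail l) (suc k) (m<n⇒m<1+n (≤-<-trans (head-≥-part l) x<k))

⊔-rankFrom-≡ : ∀ {xs} → Linked _≥_ xs → ∀ k K → (∀ j → j < K → suc (k + j) ≤ part xs (suc j)) →
  part xs (suc K) < suc (k + K) → k ⊔ rankFrom (suc k) xs ≡ k + K
⊔-rankFrom-≡ {[]}     _ k zero    _     _     = trans (⊔-identityʳ k) (sym (+-identityʳ k))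
⊔-rankFrom-≡ {[]}     _ k (suc K) above _     = contradiction (above 0 z<s) λ ()
⊔-rankFrom-≡ {x ∷ xs} l k zero    _     below = begin
  k ⊔ rankFrom (suc k) (x ∷ xs) ≡⟨ cong (k ⊔_) (rankFrom-≡0 l (suc k) (subst (λ m → x < suc m) (+-identityʳ k) below)) ⟩
  k ⊔ 0                         ≡⟨ ⊔-identityʳ k ⟩
  k                             ≡⟨ +-identityʳ k ⟨
  k + 0                         ∎
  where open ≡-Reasoning
⊔-rankFrom-≡ {x ∷ xs} l k (suc K) above below with suc k ≤? x
... | no  k≮x = contradiction (subst (λ m → suc m ≤ x) (+-identityʳ k) (above 0 z<s)) k≮x
... | yes _   = begin
  k ⊔ (suc k ⊔ rankFrom (suc (suc k)) xs) ≡⟨ ⊔-assoc k (suc k) _ ⟨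
  (k ⊔ suc k) ⊔ rankFrom (suc (suc k)) xs ≡⟨ cong (_⊔ rankFrom (suc (suc k)) xs) (m≤n⇒m⊔n≡n (n≤1+n k)) ⟩
  suc k ⊔ rankFrom (suc (suc k)) xs       ≡⟨ ⊔-rankFrom-≡ (tail l) (suc k) K above′ below′ ⟩
  suc k + K                               ≡⟨ +-suc k K ⟨
  k + suc K                               ∎
  where
  open ≡-Reasoning
  above′ : ∀ j → j < K → suc (suc k + j) ≤ part xs (suc j)
  above′ j j<K = subst (λ m → suc m ≤ part xs (suc j)) (+-suc k j) (above (suc j) (s<s j<K))
  below′ : part xs (suc K) < suc (suc k + K)
  below′ = subst (λ m → part xs (suc K) < suc m) (+-suc k K) below

rank-≡ : ∀ {lam} → Linked _≥_ lam → ∀ K → (∀ j → j < K → suc j ≤ part lam (suc j)) →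
  part lam (suc K) < suc K → rank lam ≡ K
rank-≡ l = ⊔-rankFrom-≡ l 0

module BetaNumbers {lam : List ℕ} (decreasing : Linked _≥_ lam) (M : ℕ) (ℓ≤M : length lam ≤ M) where

  β : ℕ → ℕ
  β j = part lam (suc j) + (M ∸ suc j)

  beta≡applyUpTo : beta lam M ≡ applyUpTo β M
  beta≡applyUpTo = map-upTo β M

  β+index : ∀ {j} → j < M → β j + suc j ≡ part lam (suc j) + M
  β+index {j} j<M = trans (+-assoc (part lam (suc j)) _ _) (cong (part lam (suc j) +_) (m∸n+n≡m j<M))

  β-strictlyDecreasing : ∀ {i j} → i < j → j < M → β j < β i
  β-strictlyDecreasing {i} {j} i<j j<M = +-cancelʳ-< (suc j) (β j) (β i) (begin-strict
    β j + suc j          ≡⟨ β+index j<M ⟩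
    part lam (suc j) + M ≤⟨ +-monoˡ-≤ M (part-antitone decreasing (<⇒≤ i<j)) ⟩
    part lam (suc i) + M ≡⟨ β+index (<-trans i<j j<M) ⟨
    β i + suc i          <⟨ +-monoʳ-< (β i) (s<s i<j) ⟩
    β i + suc j          ∎)
    where open ≤-Reasoning

  β-antitone : ∀ {i j} → i ≤ j → j < M → β j ≤ β i
  β-antitone i≤j j<M with m≤n⇒m<n∨m≡n i≤j
  ... | inj₁ i<j  = <⇒≤ (β-strictlyDecreasing i<j j<M)
  ... | inj₂ refl = ≤-refl

  β-injective : ∀ {i j} → i < M → j < M → β i ≡ β j → i ≡ j
  β-injective {i} {j} i<M j<M βi≡βj with <-cmp i j
  ... | tri< i<j _ _ = contradiction βi≡βj (≢-sym (<⇒≢ (β-strictlyDecreasing i<j j<M)))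
  ... | tri≈ _ i≡j _ = i≡j
  ... | tri> _ _ j<i = contradiction βi≡βj (<⇒≢ (β-strictlyDecreasing j<i i<M))

  Isβ : ℕ → Set
  Isβ y = ∃[ j ] j < M × β j ≡ y

  diagonal⇔ : ∀ {j} → j < M → suc j ≤ part lam (suc j) ⇔ M ≤ β j
  diagonal⇔ {j} j<M = mk⇔
    (λ j<λj → +-cancelʳ-≤ (suc j) M (β j) (begin
      M + suc j            ≡⟨ +-comm M (suc j) ⟩
      suc j + M            ≤⟨ +-monoˡ-≤ M j<λj ⟩
      part lam (suc j) + M ≡⟨ β+index j<M ⟨
      β j + suc j          ∎))
    (λ M≤βj → +-cancelʳ-≤ M (suc j) (part lam (suc j)) (begin
      suc j + M            ≡⟨ +-comm (suc j) M ⟩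
      M + suc j            ≤⟨ +-monoˡ-≤ (suc j) M≤βj ⟩
      β j + suc j          ≡⟨ β+index j<M ⟩
      part lam (suc j) + M ∎))
    where open ≤-Reasoning

  rank≡∑ : rank lam ≡ ∑ M (λ j → 𝟙 (M ≤? β j))
  rank≡∑ with initial-segment (λ j → M ≤? β j) M (λ i≤j j<M M≤βj → ≤-trans M≤βj (β-antitone i≤j j<M))
  ... | K , K≤M , high⇔<K = trans (rank-≡ decreasing K on-diagonal off-diagonal)
                                  (sym (∑-𝟙-initial (λ j → M ≤? β j) M K K≤M high⇔<K))
    where
    on-diagonal : ∀ j → j < K → suc j ≤ part lam (suc j)
    on-diagonal j j<K = Equivalence.from (diagonal⇔ j<M) (Equivalence.from (high⇔<K j j<M) j<K)
      where j<M = <-≤-trans j<K K≤M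
    off-diagonal : part lam (suc K) < suc K
    off-diagonal with K <? M
    ... | yes K<M = ≰⇒> (λ K<λK → n≮n K (Equivalence.to (high⇔<K K K<M) (Equivalence.to (diagonal⇔ K<M) K<λK)))
    ... | no  K≮M = subst (_< suc K) (sym (part-beyond-length lam (≤-trans ℓ≤M (≮⇒≥ K≮M)))) z<s

  hook+c+M≡ : ∀ {p c} → p < M → c ≤ part lam (suc p) → suc p ≤ conj lam c →
    hook lam (suc p) c + (c + M) ≡ β p + suc (conj lam c)
  hook+c+M≡ {p} {c} p<M c≤a p<K = +-cancelʳ-≡ (suc p) _ _ (begin
    (a ∸ c) + (K ∸ suc p) + 1 + (c + M) + suc p ≡⟨ rearrange (a ∸ c) (K ∸ suc p) c M (suc p) ⟩
    (a ∸ c) + c + M + suc (K ∸ suc p + suc p)   ≡⟨ cong₂ (λ m n → m + M + suc n) (m∸n+n≡m c≤a) (m∸n+n≡m p<K) ⟩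
    a + M + suc K                               ≡⟨ cong (_+ suc K) (β+index p<M) ⟨
    β p + suc p + suc K                         ≡⟨ xy∙z≈xz∙y (β p) (suc p) (suc K) ⟩
    β p + suc K + suc p                         ∎)
    where
    open ≡-Reasoning
    a = part lam (suc p)
    K = conj lam c
    rearrange : ∀ u v c M s → u + v + 1 + (c + M) + s ≡ u + c + M + suc (v + s)
    rearrange = solve-∀

  last-row-above : ∀ {p y} → p < M → y < β p → ¬ Isβ y →
    ∃[ k ] p ≤ k × k < M × y < β k × part lam (suc (suc k)) + M < y + suc (suc k)
  last-row-above {p} {y} p<M y<βp gap
    with initial-segment (λ j → y <? β j) M (λ i≤j j<M y<βj → <-≤-trans y<βj (β-antitone i≤j j<M))
  ... | zero  , _   , above⇔ = contradiction (Equivalence.to (above⇔ p p<M) y<βp) n≮0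
  ... | suc k , k<M , above⇔ =
    k , s≤s⁻¹ (Equivalence.to (above⇔ p p<M) y<βp) , k<M , Equivalence.from (above⇔ k k<M) (n<1+n k) , next-row-short
    where
    next-row-short : part lam (suc (suc k)) + M < y + suc (suc k)
    next-row-short with suc k <? M
    ... | yes k+1<M = begin-strict
      part lam (suc (suc k)) + M ≡⟨ β+index k+1<M ⟨
      β (suc k) + suc (suc k)    <⟨ +-monoˡ-< (suc (suc k)) βk+1<y ⟩
      y + suc (suc k)            ∎
      where
      open ≤-Reasoning
      βk+1<y : β (suc k) < y
      βk+1<y = ≤∧≢⇒< (≮⇒≥ (λ y<β → n≮n (suc k) (Equivalence.to (above⇔ (suc k) k+1<M) y<β)))
                     (λ βk+1≡y → gap (suc k , k+1<M , βk+1≡y))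
    ... | no  k+1≮M = begin-strict
      part lam (suc (suc k)) + M ≡⟨ cong (_+ M) (part-beyond-length lam (≤-trans ℓ≤M M≤k+1)) ⟩
      M                          ≤⟨ M≤k+1 ⟩
      suc k                      <⟨ n<1+n (suc k) ⟩
      suc (suc k)                ≤⟨ m≤n+m (suc (suc k)) y ⟩
      y + suc (suc k)            ∎
      where
      open ≤-Reasoning
      M≤k+1 = ≮⇒≥ k+1≮M

  -- With k as above, rows 1, …, k + 1 and no others reach the column c = y + k + 2 − M.
  gap⇒hook : ∀ {p y} → p < M → y < β p → ¬ Isβ y →
    ∃[ c ] 1 ≤ c × c ≤ part lam (suc p) × hook lam (suc p) c + y ≡ β p
  gap⇒hook {p} {y} p<M y<βp gap with last-row-above p<M y<βp gap
  ... | k , p≤k , k<M , y<βk , next-row-short = c , 1≤c , c≤a , hook≡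
    where
    M<y+k+2 : M < y + suc (suc k)
    M<y+k+2 = ≤-<-trans (m≤n+m M _) next-row-short

    c : ℕ
    c = y + suc (suc k) ∸ M

    c+M : c + M ≡ y + suc (suc k)
    c+M = m∸n+n≡m (<⇒≤ M<y+k+2)

    1≤c : 1 ≤ c
    1≤c = m<n⇒0<n∸m M<y+k+2

    c≤λk : c ≤ part lam (suc k)
    c≤λk = +-cancelʳ-≤ M c (part lam (suc k)) (begin
      c + M                ≡⟨ c+M ⟩
      y + suc (suc k)      ≡⟨ +-suc y (suc k) ⟩
      suc (y + suc k)      ≤⟨ +-monoˡ-< (suc k) y<βk ⟩
      β k + suc k          ≡⟨ β+index k<M ⟩
      part lam (suc k) + M ∎)
      where open ≤-Reasoning

    c≤a : c ≤ part lam (suc p)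
    c≤a = ≤-trans c≤λk (part-antitone decreasing p≤k)

    conj≡ : conj lam c ≡ suc k
    conj≡ = conj-≡ decreasing c (suc k) (λ j j<k+1 → ≤-trans c≤λk (part-antitone decreasing (s≤s⁻¹ j<k+1)))
                   (+-cancelʳ-< M _ c (subst (part lam (suc (suc k)) + M <_) (sym c+M) next-row-short))

    hook≡ : hook lam (suc p) c + y ≡ β p
    hook≡ = +-cancelʳ-≡ (suc (suc k)) _ _ (begin
      hook lam (suc p) c + y + suc (suc k)   ≡⟨ +-assoc (hook lam (suc p) c) y _ ⟩
      hook lam (suc p) c + (y + suc (suc k)) ≡⟨ cong (hook lam (suc p) c +_) c+M ⟨
      hook lam (suc p) c + (c + M)           ≡⟨ hook+c+M≡ p<M c≤a (subst (suc p ≤_) (sym conj≡) (s≤s p≤k)) ⟩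
      β p + suc (conj lam c)                 ≡⟨ cong (λ m → β p + suc m) conj≡ ⟩
      β p + suc (suc k)                      ∎)
      where open ≡-Reasoning

  module _ (t : ℕ) .{{_ : NonZero t}} (core : IsCore t lam) where

    Isβ-downward : ∀ y → Isβ (y + t) → Isβ y
    Isβ-downward y (p , p<M , βp≡y+t) with anyUpTo? (λ j → β j ≟ y) M
    ... | yes isβ = isβ
    ... | no  gap with gap⇒hook p<M (subst (y <_) (sym βp≡y+t) (m<m+n y (>-nonZero⁻¹ t))) gap
    ...   | c , 1≤c , c≤λp , hook+y≡βp = contradiction (subst (t ∣_) (sym hook≡t) ∣-refl)
              (core (suc p) c z<s (part-pos⇒≤length lam (≤-trans 1≤c c≤λp)) 1≤c c≤λp)
      where
      hook≡t : hook lam (suc p) c ≡ t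
      hook≡t = +-cancelˡ-≡ y _ _ (trans (+-comm y _) (trans hook+y≡βp βp≡y+t))

    Isβ-downward* : ∀ d y → Isβ (y + t * d) → Isβ y
    Isβ-downward* zero    y = subst Isβ (trans (cong (y +_) (*-zeroʳ t)) (+-identityʳ y))
    Isβ-downward* (suc d) y = Isβ-downward y ∘ Isβ-downward* d (y + t) ∘ subst Isβ y+t*[1+d]≡
      where
      y+t*[1+d]≡ : y + t * suc d ≡ y + t + t * d
      y+t*[1+d]≡ = trans (cong (y +_) (*-suc t d)) (sym (+-assoc y t (t * d)))

    βs-above≡nres∸ : ∀ i → i < t → ∀ k →
      ∑ M (λ j → 𝟙 (β j % t ≟ i) * 𝟙 (t * k ≤? β j)) ≡ nres t i lam M ∸ k
    βs-above≡nres∸ i i<t k = begin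
      above k          ≡⟨ unit-decrements⇒≡∸ above at split at≤1 at≥1 k ⟩
      above 0 ∸ k      ≡⟨ cong (_∸ k) above-0≡nres ⟩
      nres t i lam M ∸ k ∎
      where
      open ≡-Reasoning
      above : ℕ → ℕ
      above k = ∑ M (λ j → 𝟙 (β j % t ≟ i) * 𝟙 (t * k ≤? β j))
      at : ℕ → ℕ
      at k = ∑ M (λ j → 𝟙 (β j ≟ i + t * k))

      split : ∀ k → above k ≡ above (suc k) + at k
      split k = trans (∑-cong M (λ j _ → residue-threshold-split t i k (β j) i<t)) (∑-distrib-+ M _ _)

      at≤1 : ∀ k → at k ≤ 1
      at≤1 k = ∑-𝟙-≟-≤1 M β (i + t * k) β-injective

      at≥1 : ∀ k → 0 < above k → 1 ≤ at k
      at≥1 k above>0 with ∑-pos M _ above>0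
      ... | j , j<M , term>0 with 𝟙-*-pos (β j % t ≟ i) (t * k ≤? β j) term>0
      ... | βj%t≡i , tk≤βj with x%t≡i∧t*k≤x⇒x≡i+t*k+t*d t (β j) i k i<t βj%t≡i tk≤βj
      ... | d , βj≡ with Isβ-downward* d (i + t * k) (j , j<M , βj≡)
      ... | j′ , j′<M , βj′≡ = subst (_≤ at k) (𝟙-yes βj′≡ (β j′ ≟ i + t * k)) (≤-∑ M _ j′<M)

      above-0≡nres : above 0 ≡ nres t i lam M
      above-0≡nres = sym (begin
        length (filter (λ b → b % t ≟ i) (beta lam M))    ≡⟨ cong (length ∘ filter (λ b → b % t ≟ i)) beta≡applyUpTo ⟩
        length (filter (λ b → b % t ≟ i) (applyUpTo β M)) ≡⟨ length-filter-applyUpTo (λ b → b % t ≟ i) β M ⟩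
        ∑ M (λ j → 𝟙 (β j % t ≟ i))                       ≡⟨ ∑-cong M (λ j _ → sym (above-0 (β j))) ⟩
        above 0                                           ∎)
        where
        above-0 : ∀ x → 𝟙 (x % t ≟ i) * 𝟙 (t * 0 ≤? x) ≡ 𝟙 (x % t ≟ i)
        above-0 x = trans (cong (𝟙 (x % t ≟ i) *_) (𝟙-yes (subst (_≤ x) (sym (*-zeroʳ t)) z≤n) (t * 0 ≤? x)))
                          (*-identityʳ _)

∑-𝟙-% : ∀ t .{{_ : NonZero t}} x → ∑ t (λ i → 𝟙 (x % t ≟ i)) ≡ 1
∑-𝟙-% t x = ∑-𝟙-≟ t (x % t) (m%n<n x t)

lemma3p10 : (t n : ℕ) .{{_ : NonZero t}} (lam : List ℕ) →
    2 ≤ t → 1 ≤ n → IsPartition lam → IsCore t lam → length lam ≤ t * n →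
    rank lam ≡ sum (map (λ i → nres t i lam (t * n) ∸ n) (upTo t))
lemma3p10 t n lam _ _ (_ , decreasing) core ℓ≤M = begin
  rank lam                                                 ≡⟨ rank≡∑ ⟩
  ∑ M (λ j → 𝟙 (M ≤? β j))                                 ≡⟨ ∑-cong M (λ j _ → split-by-residue (β j)) ⟨
  ∑ M (λ j → ∑ t (λ i → 𝟙 (β j % t ≟ i) * 𝟙 (M ≤? β j))) ≡⟨ ∑-comm M t _ ⟩
  ∑ t (λ i → ∑ M (λ j → 𝟙 (β j % t ≟ i) * 𝟙 (M ≤? β j))) ≡⟨ ∑-cong t (λ i i<t → βs-above≡nres∸ t core i i<t n) ⟩
  ∑ t (λ i → nres t i lam M ∸ n)                           ≡⟨ cong sum (map-upTo _ t) ⟨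
  sum (map (λ i → nres t i lam M ∸ n) (upTo t))            ∎
  where
  open ≡-Reasoning
  M = t * n
  open BetaNumbers decreasing M ℓ≤M
  split-by-residue : ∀ x → ∑ t (λ i → 𝟙 (x % t ≟ i) * 𝟙 (M ≤? x)) ≡ 𝟙 (M ≤? x)
  split-by-residue x = trans (∑-distribʳ-* t _ (𝟙 (M ≤? x)))
                             (trans (cong (_* 𝟙 (M ≤? x)) (∑-𝟙-% t x)) (*-identityˡ _))
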